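{- For any two finite integer sequences $A$ and $B$, $\mathrm{lcis}(\mathrm{inflate}(A),\mathrm{inflate}(B)) = 2\cdot \mathrm{lcis}(A,B)$.
   Context: For integer sequences, $\mathrm{lcis}(X_1,\dots,X_k)$ denotes the length of a longest strictly increasing sequence that is a common subsequence of $X_1,\dots,X_k$. For $A=\langle a_0,\dots,a_{n-1}\rangle$, $\mathrm{inflate}(A)=\langle 2a_0-1,2a_0,2a_1-1,2a_1,\dots,2a_{n-1}-1,2a_{n-1}\rangle$. -}

module Defs where

open import Data.Nat using (ℕ; _≤_)
open import Data.Integer using (ℤ; _<_; _-_; _*_; +_)
open import Data.List using (List; []; _∷_; length)
open import Data.List.Relation.Binary.Sublist.Propositional using (_⊆_)
open import Data.List.Relation.Unary.Linked using (Linked)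
open import Data.Product using (_×_; ∃)
open import Relation.Binary.PropositionalEquality using (_≡_)

StrictlyIncreasing : List ℤ → Set
StrictlyIncreasing = Linked _<_

IsCIS : List ℤ → List ℤ → List ℤ → Set
IsCIS A B C = StrictlyIncreasing C × C ⊆ A × C ⊆ B

IsLCIS : List ℤ → List ℤ → ℕ → Set
IsLCIS A B k = (∃ λ C → IsCIS A B C × length C ≡ k)
             × ((C : List ℤ) → IsCIS A B C → length C ≤ k)

inflate : List ℤ → List ℤ
inflate [] = []
inflate (a ∷ as) = (+ 2 * a - + 1) ∷ (+ 2 * a) ∷ inflate as

-- Inflating a common strictly increasing subsequence of A and B gives one of
-- inflate A and inflate B of twice the length. Conversely, let D be a strictly
-- increasing common subsequence of the inflated lists. Entries of D two places
-- apart differ by at least 2, so x ↦ ⌈x/2⌉ is strictly increasing along every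
-- other entry of D. As ⌈_/2⌉ maps inflate A to A with every entry repeated, the
-- halved entries form a common strictly increasing subsequence of A and B whose
-- length is at least half that of D.
module Submission where

open import Defs
open import Data.Empty using (⊥-elim)
open import Data.Integer.Base using (ℤ)
open import Data.Integer.Properties using (<⇒≢)
open import Data.List using (List; []; _∷_; length; map)
open import Data.List.Properties using (length-map)
open import Data.List.Relation.Binary.Sublist.Propositional using (_⊆_; []; _∷ʳ_; _∷_; ⊆-trans)
open import Data.List.Relation.Binary.Sublist.Propositional.Properties using () renaming (map⁺ to ⊆-map⁺)
open import Data.List.Relation.Unary.Linked as Linked using (Linked; []; [-]; _∷_)
open import Data.List.Relation.Unary.Linked.Properties using () renaming (map⁺ to Linked-map⁺)
open import Data.Product using (_,_)
open import Function using (_∘_)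
open import Level using (Level)
open import Relation.Binary.Core using (Rel)
open import Relation.Binary.Definitions using (Trans)
open import Relation.Binary.PropositionalEquality using (_≡_; _≢_; refl; sym; trans; cong; cong₂; subst)

-- Opened locally because the integer operators share their names with the ℕ ones used below.
module _ where
  open import Data.Integer.Base using (+_; _+_; _-_; _*_; _≤_; _<_; suc; _/ℕ_)
  open import Data.Integer.Properties
  open import Data.Integer.DivMod using ([n/ℕd]*d≤n; n<s[n/ℕd]*d)
  open import Data.Integer.Tactic.RingSolver using (solve-∀)

  <-suc⇒≤ : ∀ {x y} → x < suc y → x ≤ y
  <-suc⇒≤ {y = y} x<sy = subst (_ ≤_) (pred-suc y) (i<j⇒i≤pred[j] x<sy)

  suc-cancel-≤ : ∀ {x y} → suc x ≤ suc y → x ≤ y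
  suc-cancel-≤ = <-suc⇒≤ ∘ suc[i]≤j⇒i<j

  twice-suc : ∀ q → + 2 * (+ 1 + q) ≡ + 1 + (+ 1 + + 2 * q)
  twice-suc = solve-∀

  suc[2*a-1]≡2*a : ∀ a → + 1 + (+ 2 * a - + 1) ≡ + 2 * a
  suc[2*a-1]≡2*a = solve-∀

  -- ⌈ x /2⌉ is the a with x ∈ {2a - 1, 2a}.
  ⌈_/2⌉ : ℤ → ℤ
  ⌈ x /2⌉ = suc x /ℕ 2

  ⌈/2⌉-lower : ∀ x → + 2 * ⌈ x /2⌉ ≤ suc x
  ⌈/2⌉-lower x = subst (_≤ suc x) (*-comm ⌈ x /2⌉ (+ 2)) ([n/ℕd]*d≤n (suc x) 2)

  ⌈/2⌉-upper : ∀ x → x ≤ + 2 * ⌈ x /2⌉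
  ⌈/2⌉-upper x = suc-cancel-≤ (<-suc⇒≤ (subst (suc x <_) eq (n<s[n/ℕd]*d (suc x) 2)))
    where
    eq : suc ⌈ x /2⌉ * + 2 ≡ suc (suc (+ 2 * ⌈ x /2⌉))
    eq = trans (*-comm (suc ⌈ x /2⌉) (+ 2)) (twice-suc ⌈ x /2⌉)

  2*p≤suc[2*q]⇒p≤q : ∀ {p q} → + 2 * p ≤ suc (+ 2 * q) → p ≤ q
  2*p≤suc[2*q]⇒p≤q {p} {q} 2p≤1+2q =
    <-suc⇒≤ (*-cancelˡ-<-nonNeg (+ 2) (≤-<-trans 2p≤1+2q 1+2q<2+2q))
    where
    1+2q<2+2q : suc (+ 2 * q) < + 2 * suc q
    1+2q<2+2q = subst (suc (+ 2 * q) <_) (sym (twice-suc q)) (suc[i]≤j⇒i<j ≤-refl)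

  ⌈/2⌉-unique : ∀ {x a} → x ≤ + 2 * a → + 2 * a ≤ suc x → ⌈ x /2⌉ ≡ a
  ⌈/2⌉-unique {x} x≤2a 2a≤1+x = ≤-antisym
    (2*p≤suc[2*q]⇒p≤q (≤-trans (⌈/2⌉-lower x) (suc-mono x≤2a)))
    (2*p≤suc[2*q]⇒p≤q (≤-trans 2a≤1+x (suc-mono (⌈/2⌉-upper x))))

  ⌈2*a/2⌉≡a : ∀ a → ⌈ + 2 * a /2⌉ ≡ a
  ⌈2*a/2⌉≡a a = ⌈/2⌉-unique ≤-refl (i≤suc[i] _)

  ⌈2*a-1/2⌉≡a : ∀ a → ⌈ + 2 * a - + 1 /2⌉ ≡ a
  ⌈2*a-1/2⌉≡a a = ⌈/2⌉-unique (i-j≤i _ (+ 1)) (≤-reflexive (sym (suc[2*a-1]≡2*a a)))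

  ⌈/2⌉-<-< : Trans _<_ _<_ (λ x z → ⌈ x /2⌉ < ⌈ z /2⌉)
  ⌈/2⌉-<-< {x} {y} {z} x<y y<z = *-cancelˡ-<-nonNeg (+ 2) (begin-strict
    + 2 * ⌈ x /2⌉  ≤⟨ ⌈/2⌉-lower x ⟩
    suc x          ≤⟨ i<j⇒suc[i]≤j x<y ⟩
    y              <⟨ y<z ⟩
    z              ≤⟨ ⌈/2⌉-upper z ⟩
    + 2 * ⌈ z /2⌉  ∎)
    where open ≤-Reasoning

  2*a-1<2*a : ∀ a → + 2 * a - + 1 < + 2 * a
  2*a-1<2*a a = suc[i]≤j⇒i<j (≤-reflexive (suc[2*a-1]≡2*a a))

  <⇒2*a<2*b-1 : ∀ {a b} → a < b → + 2 * a < + 2 * b - + 1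
  <⇒2*a<2*b-1 {a} {b} a<b = suc[i]≤j⇒i<j (suc-cancel-≤ (begin
    + 1 + (+ 1 + + 2 * a)  ≡⟨ twice-suc a ⟨
    + 2 * suc a            ≤⟨ *-monoˡ-≤-nonNeg (+ 2) (i<j⇒suc[i]≤j a<b) ⟩
    + 2 * b                ≡⟨ suc[2*a-1]≡2*a b ⟨
    suc (+ 2 * b - + 1)    ∎))
    where open ≤-Reasoning

open import Data.Nat using (ℕ; _+_; _*_; _≤_; z≤n; s≤s)
open import Data.Nat.Properties using (*-suc; ≤-trans; *-monoʳ-≤)

private
  variable
    a ℓ₁ ℓ₂ : Level
    A : Set a
    xs ys : List A

stutter : List A → List A
stutter []       = []
stutter (x ∷ xs) = x ∷ x ∷ stutter xs

Linked-≢-stutter⇒⊆ : Linked _≢_ xs → xs ⊆ stutter ys → xs ⊆ ys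
Linked-≢-stutter⇒⊆ {ys = []}    _         []                  = []
Linked-≢-stutter⇒⊆ {ys = y ∷ _} L         (_ ∷ʳ (_ ∷ʳ τ))     = y ∷ʳ Linked-≢-stutter⇒⊆ L τ
Linked-≢-stutter⇒⊆ {ys = _ ∷ _} L         (_ ∷ʳ (refl ∷ τ))   = refl ∷ Linked-≢-stutter⇒⊆ (Linked.tail L) τ
Linked-≢-stutter⇒⊆ {ys = _ ∷ _} L         (refl ∷ (_ ∷ʳ τ))   = refl ∷ Linked-≢-stutter⇒⊆ (Linked.tail L) τ
Linked-≢-stutter⇒⊆ {ys = _ ∷ _} (y≢y ∷ _) (refl ∷ (refl ∷ _)) = ⊥-elim (y≢y refl)

evens : List A → List A
evens []           = []
evens (x ∷ [])     = x ∷ []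
evens (x ∷ _ ∷ xs) = x ∷ evens xs

evens-⊆ : ∀ (xs : List A) → evens xs ⊆ xs
evens-⊆ []           = []
evens-⊆ (x ∷ [])     = refl ∷ []
evens-⊆ (x ∷ y ∷ xs) = refl ∷ (y ∷ʳ evens-⊆ xs)

length≤2*length-evens : ∀ (xs : List A) → length xs ≤ 2 * length (evens xs)
length≤2*length-evens []           = z≤n
length≤2*length-evens (x ∷ [])     = s≤s z≤n
length≤2*length-evens (x ∷ y ∷ xs) =
  subst (length (x ∷ y ∷ xs) ≤_) (sym (*-suc 2 _)) (s≤s (s≤s (length≤2*length-evens xs)))

Linked-evens : {R : Rel A ℓ₁} {S : Rel A ℓ₂} → Trans R R S → Linked R xs → Linked S (evens xs)
Linked-evens _    []                      = []
Linked-evens _    [-]                     = [-]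
Linked-evens _    (_ ∷ [-])               = [-]
Linked-evens RR⇒S (Rxy ∷ Ryz ∷ [-])       = RR⇒S Rxy Ryz ∷ [-]
Linked-evens RR⇒S (Rxy ∷ Ryz ∷ L@(_ ∷ _)) = RR⇒S Rxy Ryz ∷ Linked-evens RR⇒S L

inflate⁺ : xs ⊆ ys → inflate xs ⊆ inflate ys
inflate⁺ []         = []
inflate⁺ (_ ∷ʳ τ)   = _ ∷ʳ (_ ∷ʳ inflate⁺ τ)
inflate⁺ (refl ∷ τ) = refl ∷ (refl ∷ inflate⁺ τ)

inflate-increasing : ∀ {C} → StrictlyIncreasing C → StrictlyIncreasing (inflate C)
inflate-increasing {[]}    []          = []
inflate-increasing {a ∷ _} [-]         = 2*a-1<2*a a ∷ [-]
inflate-increasing {a ∷ _} (a<b ∷ inc) = 2*a-1<2*a a ∷ <⇒2*a<2*b-1 a<b ∷ inflate-increasing inc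

length-inflate : ∀ C → length (inflate C) ≡ 2 * length C
length-inflate []      = refl
length-inflate (a ∷ C) = trans (cong (2 +_) (length-inflate C)) (sym (*-suc 2 (length C)))

inflate-CIS : ∀ {A B C} → IsCIS A B C → IsCIS (inflate A) (inflate B) (inflate C)
inflate-CIS (inc , C⊆A , C⊆B) = inflate-increasing inc , inflate⁺ C⊆A , inflate⁺ C⊆B

map-⌈/2⌉-inflate : ∀ A → map ⌈_/2⌉ (inflate A) ≡ stutter A
map-⌈/2⌉-inflate []      = refl
map-⌈/2⌉-inflate (a ∷ A) =
  cong₂ _∷_ (⌈2*a-1/2⌉≡a a) (cong₂ _∷_ (⌈2*a/2⌉≡a a) (map-⌈/2⌉-inflate A))

deflate : List ℤ → List ℤ
deflate D = map ⌈_/2⌉ (evens D)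

deflate-increasing : ∀ {D} → StrictlyIncreasing D → StrictlyIncreasing (deflate D)
deflate-increasing = Linked-map⁺ ∘ Linked-evens ⌈/2⌉-<-<

deflate-⊆ : ∀ {A D} → StrictlyIncreasing D → D ⊆ inflate A → deflate D ⊆ A
deflate-⊆ {A} {D} inc D⊆A = Linked-≢-stutter⇒⊆ (Linked.map <⇒≢ (deflate-increasing inc))
  (subst (deflate D ⊆_) (map-⌈/2⌉-inflate A) (⊆-map⁺ ⌈_/2⌉ (⊆-trans (evens-⊆ D) D⊆A)))

deflate-CIS : ∀ {A B D} → IsCIS (inflate A) (inflate B) D → IsCIS A B (deflate D)
deflate-CIS (inc , D⊆A , D⊆B) = deflate-increasing inc , deflate-⊆ inc D⊆A , deflate-⊆ inc D⊆B

length≤2*length-deflate : ∀ D → length D ≤ 2 * length (deflate D)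
length≤2*length-deflate D =
  subst (λ n → length D ≤ 2 * n) (sym (length-map ⌈_/2⌉ (evens D))) (length≤2*length-evens D)

lemma12 : (A B : List ℤ) (k : ℕ) → IsLCIS A B k → IsLCIS (inflate A) (inflate B) (2 * k)
lemma12 A B k ((C , cis , refl) , maximal) =
  (inflate C , inflate-CIS cis , length-inflate C) ,
  λ D cis′ → ≤-trans (length≤2*length-deflate D) (*-monoʳ-≤ 2 (maximal (deflate D) (deflate-CIS cis′)))
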